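{- Let $\mathcal{B}$ be a choice on $[m]$ and $X\subseteq[m]$. Then $c(\mathcal{B},X)\le |X|+b(\mathcal{B},X)+1$.
   Context: For $|T|=3$ and $x\in T$, $e_x\in\{0,1\}^T$ has a 1 at $x$ and 0 elsewhere, $\bar e_x=\mathbf 1-e_x$. A choice on $[m]$ is a family $\mathcal{B}=(B_T)_{T\in\binom{[m]}{3}}$ with each $B_T\subseteq\{0,1\}^T$ containing exactly one vector from each pair $\{e_x,\bar e_x\}$, $x\in T$; $B_T$ is of type $I$ if $B_T=\{e_x\}_{x\in T}$ and of type $I^c$ if $B_T=\{\bar e_x\}_{x\in T}$. For $X\subseteq[m]$, $c(\mathcal{B},X)$ is the number of $u\in\{0,1\}^X$ with $u|_T\notin B_T$ for every 3-subset $T\subseteq X$. $\mathcal{D}_{\mathcal{B}}(X)$ is the directed multigraph on $X$ which, for each 3-subset $T\subseteq X$ and each ordered pair $(x,y)$ of distinct elements of $T$ such that both vectors $u\in\{0,1\}^T$ with $u_x=0,u_y=1$ lie in $B_T$, has one edge $x\to y$. Let $R$ be the smallest set of ordered pairs of distinct elements of $X$ such that: $R$ contains $(x,y)$ whenever $\mathcal{D}_{\mathcal{B}}(X)$ has an edge $x\to y$; if $(i,j),(j,k)\in R$ with $i,j,k$ distinct then $(i,k)\in R$; if $i,j,k\in X$ are distinct, $B_{\{i,j,k\}}$ is of type $I$ and $(i,j)\in R$ then $(i,k)\in R$; if $B_{\{i,j,k\}}$ is of type $I^c$ and $(i,j)\in R$ then $(k,j)\in R$. Distinct $i,j\in X$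 are independent if $(i,j)\notin R$ and $(j,i)\notin R$. The blocks of $X$ are the connected components of the graph on $X$ whose edges are the independent pairs, and $b(\mathcal{B},X)$ is the number of blocks of size at least 2. -}

module Defs where

open import Data.Nat.Base using (ℕ; zero; suc)
open import Data.Bool.Base using (Bool; true; false; _∧_; _∨_; not; if_then_else_)
open import Data.Fin.Base using (Fin; _<_)
open import Data.Fin.Properties using (_<?_)
open import Data.Fin.Subset using (Subset; _∈_)
open import Data.Vec.Base using (Vec; []; _∷_; lookup)
open import Data.List.Base using (List; []; _∷_; [_]; concatMap; allFin; length; foldr; filterᵇ)
open import Data.Product.Base using (_×_; Σ; ∃-syntax)
open import Data.Sum.Base using (_⊎_)
open import Relation.Nullary using (¬_)
open import Relation.Nullary.Decidable using (⌊_⌋)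
open import Relation.Binary.PropositionalEquality using (_≡_)

-- A 3-subset T = {x, y, z} of [m] (x, y, z distinct) together with a
-- distinguished element x ∈ T is presented as  sel x y z.
-- sel x y z ≡ true   means  e_x ∈ B_{x,y,z}
-- sel x y z ≡ false  means  ē_x ∈ B_{x,y,z}
-- (exactly one of e_x, ē_x lies in B_T, as required).  Since T = {x,y,z}
-- does not depend on the order of y and z, we require symmetry in y, z.
-- Values of sel at non-distinct triples are irrelevant and never used.

record Choice (m : ℕ) : Set where
  field
    sel     : Fin m → Fin m → Fin m → Bool
    sel-sym : ∀ x y z → sel x y z ≡ sel x z y
open Choice public

module _ {m : ℕ} (B : Choice m) where

  -- Membership of a vector u ∈ {0,1}^T in B_T, for T = {a, b, c} with
  -- a, b, c distinct; u is given by its three coordinates ua, ub, uc.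
  -- e_a = (1,0,0), ē_a = (0,1,1) (coordinates in the order a, b, c), etc.
  isE : Bool → Bool → Bool → Bool
  isE p q r = p ∧ not q ∧ not r

  isEbar : Bool → Bool → Bool → Bool
  isEbar p q r = not p ∧ q ∧ r

  memB : Fin m → Fin m → Fin m → Bool → Bool → Bool → Bool
  memB a b c ua ub uc =
       (if sel B a b c then isE ua ub uc else isEbar ua ub uc)
    ∨ (if sel B b a c then isE ub ua uc else isEbar ub ua uc)
    ∨ (if sel B c a b then isE uc ua ub else isEbar uc ua ub)

  TypeI : Fin m → Fin m → Fin m → Set
  TypeI x y z = (sel B x y z ≡ true) × (sel B y x z ≡ true) × (sel B z x y ≡ true)

  TypeIc : Fin m → Fin m → Fin m → Set
  TypeIc x y z = (sel B x y z ≡ false) × (sel B y x z ≡ false) × (sel B z x y ≡ false)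

  -- Condition for an edge x → y of D_B(X) coming from T = {x, y, z}:
  -- both vectors u ∈ {0,1}^T with u_x = 0, u_y = 1 lie in B_T.
  EdgeCond : Fin m → Fin m → Fin m → Set
  EdgeCond x y z = (memB x y z false true false ≡ true)
                 × (memB x y z false true true ≡ true)

  Distinct3 : Fin m → Fin m → Fin m → Set
  Distinct3 i j k = ¬ (i ≡ j) × ¬ (j ≡ k) × ¬ (i ≡ k)

  module _ (X : Subset m) where

    -- c(B, X): vectors u ∈ {0,1}^X are encoded as u : Vec Bool m with
    -- u_i = false for all i ∉ X (bijection with {0,1}^X).

    allᵇ : {A : Set} → (A → Bool) → List A → Bool
    allᵇ p = foldr (λ a r → p a ∧ r) true

    allVecs : (n : ℕ) → List (Vec Bool n)
    allVecs zero    = [ [] ]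
    allVecs (suc n) = concatMap (λ v → (false ∷ v) ∷ (true ∷ v) ∷ []) (allVecs n)

    inXᵇ : Fin m → Bool
    inXᵇ i = lookup X i

    supportedᵇ : Vec Bool m → Bool
    supportedᵇ u = allᵇ (λ i → not (lookup u i) ∨ inXᵇ i) (allFin m)

    avoidsᵇ : Vec Bool m → Bool
    avoidsᵇ u =
      allᵇ (λ a → allᵇ (λ b → allᵇ (λ c →
        not (inXᵇ a ∧ inXᵇ b ∧ inXᵇ c ∧ ⌊ a <? b ⌋ ∧ ⌊ b <? c ⌋)
        ∨ not (memB a b c (lookup u a) (lookup u b) (lookup u c)))
        (allFin m)) (allFin m)) (allFin m)

    c : ℕ
    c = length (filterᵇ (λ u → supportedᵇ u ∧ avoidsᵇ u) (allVecs m))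

    data R : Fin m → Fin m → Set where
      edge   : ∀ {x y z} → x ∈ X → y ∈ X → z ∈ X → Distinct3 x y z →
               EdgeCond x y z → R x y
      trans  : ∀ {i j k} → Distinct3 i j k → R i j → R j k → R i k
      ruleI  : ∀ {i j k} → k ∈ X → Distinct3 i j k → TypeI i j k →
               R i j → R i k
      ruleIc : ∀ {i j k} → k ∈ X → Distinct3 i j k → TypeIc i j k →
               R i j → R k j

    Indep : Fin m → Fin m → Set
    Indep i j = i ∈ X × j ∈ X × ¬ (i ≡ j) × ¬ R i j × ¬ R j i

    data Conn : Fin m → Fin m → Set where
      here : ∀ {i} → i ∈ X → Conn i i
      step : ∀ {i j k} → Indep i j → Conn j k → Conn i k

    -- i lies in a block of size ≥ 2 iff it has an independent partner
    InBigBlock : Fin m → Set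
    InBigBlock i = ∃[ j ] Indep i j

    -- IsBlockCount n  ⇔  b(B, X) = n : there are representatives
    -- r 0, …, r (n-1) of pairwise distinct blocks of size ≥ 2, and every
    -- block of size ≥ 2 contains one of them.
    IsBlockCount : ℕ → Set
    IsBlockCount n = Σ (Fin n → Fin m) λ r →
        (∀ k → InBigBlock (r k))
      × (∀ k l → Conn (r k) (r l) → k ≡ l)
      × (∀ i → InBigBlock i → ∃[ k ] Conn i (r k))

-- Let G be the set of vectors counted by c(B, X). Deleting the first coordinate
-- maps G onto its shadow G′, and |G| = |G′| + |D| where D is the set of w both of
-- whose extensions lie in G. If R x y, no u ∈ G has u_x = 0 and u_y = 1, so two
-- vectors of D that differ at j make the first coordinate independent of j; and j
-- is then its only later independent element, because an independent triple is of
-- type I or I^c and so cannot carry vectors of weight 1 and of weight 2. Hence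
-- |D| ≤ 2 if the first coordinate has exactly one later independent element,
-- |D| ≤ 1 otherwise, and D = ∅ off X. Induction gives c(B, X) ≤ |X| + E + 1, where
-- E counts the elements with exactly one later independent element. Independence
-- is transitive on distinct elements, so blocks are cliques and each contains at
-- most one such element: E ≤ b(B, X).

module Submission where

open import Defs
open import Data.Nat.Base using (ℕ; _≤_; _+_)
open import Data.Fin.Subset using (Subset; ∣_∣)

open import Algebra.Bundles using (CommutativeMonoid)
open import Data.Bool.Base using (Bool; true; false; _∧_; _∨_; not; if_then_else_)
open import Data.Bool.Properties
  using (∧-comm; ∨-comm; ∨-commutativeMonoid; not-injective; T-≡) renaming (_≟_ to _≟ᵇ_)
open import Data.Empty using (⊥; ⊥-elim)
open import Data.Fin.Base using (Fin; zero; suc; punchOut) renaming (_<_ to _<ᶠ_)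
open import Data.Fin.Properties
  using (<-cmp; <-trans; <-irrefl; <⇒≢; punchOut-injective; sequence)
  renaming (suc-injective to sucᶠ-injective; _≟_ to _≟ᶠ_; _<?_ to _<ᶠ?_)
open import Data.Fin.Subset using (_∈_)
open import Data.Fin.Subset.Properties using (_∈?_)
open import Data.List.Base using (List; []; _∷_; [_]; concatMap; length; filterᵇ; allFin)
import Data.List.Membership.Propositional as List
open import Data.List.Membership.Propositional.Properties using (∈-allFin)
open import Data.List.Relation.Unary.Any using (here; there)
open import Data.Nat.Base using (zero; suc; z≤n; s≤s; _≡ᵇ_)
open import Data.Nat.Properties
  using (≤-refl; ≤-reflexive; +-mono-≤; +-monoˡ-≤; +-assoc; +-suc; +-identityʳ; _≤?_;
         ≡ᵇ⇒≡; ≡⇒≡ᵇ; +-commutativeSemigroup; suc-injective; module ≤-Reasoning)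
open import Data.Nat.Tactic.RingSolver using (solve-∀)
open import Data.Product.Base using (_×_; _,_; proj₁; proj₂; ∃-syntax)
open import Data.Sum.Base using (_⊎_; inj₁; inj₂)
open import Data.Vec.Base using (Vec; []; _∷_; lookup)
open import Data.Vec.Properties
  using (∷-injectiveʳ; tabulate∘lookup; tabulate-cong; []=⇒lookup; lookup⇒[]=)
open import Effect.Applicative using (RawApplicative)
open import Effect.Monad using (RawMonad)
open import Function.Base using (_∘_; case_of_)
open import Function.Bundles using (Equivalence)
open import Relation.Binary.Definitions using (tri<; tri≈; tri>)
open import Relation.Binary.PropositionalEquality
  using (_≡_; _≢_; refl; sym; cong; cong₂; subst; ≢-sym; module ≡-Reasoning)
  renaming (trans to ≡-trans)
open import Relation.Nullary using (¬_; Dec; yes; no; does; contradiction)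
open import Relation.Nullary.Decidable
  using (⌊_⌋; dec-true; decidable-stable; ¬¬-excluded-middle; isYes≗does; _×-dec_; ¬?)
open import Relation.Nullary.Negation using (DoubleNegation; ¬¬-Monad; ¬¬-map)

open import Algebra.Properties.CommutativeSemigroup +-commutativeSemigroup
  using () renaming (interchange to +-interchange)
open import Algebra.Properties.CommutativeSemigroup
  (CommutativeMonoid.commutativeSemigroup ∨-commutativeMonoid)
  using () renaming (x∙yz≈y∙xz to ∨-leftComm)

fromBool : Bool → ℕ
fromBool true  = 1
fromBool false = 0

fromBool≤1 : ∀ b → fromBool b ≤ 1
fromBool≤1 true  = ≤-refl
fromBool≤1 false = z≤n

fromBool-∨+∧ : ∀ a b → fromBool a + fromBool b ≡ fromBool (a ∨ b) + fromBool (a ∧ b)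
fromBool-∨+∧ true  true  = refl
fromBool-∨+∧ true  false = refl
fromBool-∨+∧ false true  = refl
fromBool-∨+∧ false false = refl

∧-true : ∀ {a b} → a ∧ b ≡ true → a ≡ true × b ≡ true
∧-true {true} {true} _ = refl , refl

∨-true : ∀ {a b} → a ∨ b ≡ true → a ≡ true ⊎ b ≡ true
∨-true {true}  _  = inj₁ refl
∨-true {false} eq = inj₂ eq

does⇒ : ∀ {A : Set} (a? : Dec A) → does a? ≡ true → A
does⇒ (yes a) _ = a

does≡false⇒¬ : ∀ {A : Set} (a? : Dec A) → does a? ≡ false → ¬ A
does≡false⇒¬ (no ¬a) _ = ¬a

module _ {A : Set} where

  count : (A → Bool) → List A → ℕ
  count P []       = 0
  count P (x ∷ xs) = fromBool (P x) + count P xs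

  length-filterᵇ : (P : A → Bool) (xs : List A) → length (filterᵇ P xs) ≡ count P xs
  length-filterᵇ P []       = refl
  length-filterᵇ P (x ∷ xs) with P x
  ... | true  = cong suc (length-filterᵇ P xs)
  ... | false = length-filterᵇ P xs

  count-∨+∧ : (P Q : A → Bool) (xs : List A) →
    count P xs + count Q xs ≡ count (λ x → P x ∨ Q x) xs + count (λ x → P x ∧ Q x) xs
  count-∨+∧ P Q []       = refl
  count-∨+∧ P Q (x ∷ xs) = begin
    (fromBool (P x) + count P xs) + (fromBool (Q x) + count Q xs)
      ≡⟨ +-interchange (fromBool (P x)) _ _ _ ⟩
    (fromBool (P x) + fromBool (Q x)) + (count P xs + count Q xs)
      ≡⟨ cong₂ _+_ (fromBool-∨+∧ (P x) (Q x)) (count-∨+∧ P Q xs) ⟩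
    (fromBool (P x ∨ Q x) + fromBool (P x ∧ Q x)) + (count P∨Q xs + count P∧Q xs)
      ≡⟨ +-interchange (fromBool (P x ∨ Q x)) _ _ _ ⟩
    (fromBool (P x ∨ Q x) + count P∨Q xs) + (fromBool (P x ∧ Q x) + count P∧Q xs) ∎
    where
    open ≡-Reasoning
    P∨Q P∧Q : A → Bool
    P∨Q y = P y ∨ Q y
    P∧Q y = P y ∧ Q y

  count-split : (P q : A → Bool) (xs : List A) →
    count P xs ≡ count (λ x → P x ∧ q x) xs + count (λ x → P x ∧ not (q x)) xs
  count-split P q []       = refl
  count-split P q (x ∷ xs) with P x | q x
  ... | true  | true  = cong suc (count-split P q xs)
  ... | true  | false = ≡-trans (cong suc (count-split P q xs)) (sym (+-suc _ _))
  ... | false | _     = count-split P q xs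

  count-none : (P : A → Bool) (xs : List A) → (∀ x → P x ≢ true) → count P xs ≡ 0
  count-none P []       none = refl
  count-none P (x ∷ xs) none with P x in Px
  ... | true  = contradiction Px (none x)
  ... | false = count-none P xs none

  count≡0⊎witness : (P : A → Bool) (xs : List A) → count P xs ≡ 0 ⊎ ∃[ x ] P x ≡ true
  count≡0⊎witness P []       = inj₁ refl
  count≡0⊎witness P (x ∷ xs) with P x in Px
  ... | true  = inj₂ (x , Px)
  ... | false = count≡0⊎witness P xs

  Unique : (A → Bool) → Set
  Unique P = ∀ {x y} → P x ≡ true → P y ≡ true → x ≡ y

cube : (n : ℕ) → List (Vec Bool n)
cube zero    = [ [] ]
cube (suc n) = concatMap (λ v → (false ∷ v) ∷ (true ∷ v) ∷ []) (cube n)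

count-cube-suc : ∀ {n} (P : Vec Bool (suc n) → Bool) →
  count P (cube (suc n)) ≡ count (P ∘ (false ∷_)) (cube n) + count (P ∘ (true ∷_)) (cube n)
count-cube-suc {n} P = go (cube n)
  where
  go : (ws : List (Vec Bool n)) →
    count P (concatMap (λ v → (false ∷ v) ∷ (true ∷ v) ∷ []) ws)
      ≡ count (P ∘ (false ∷_)) ws + count (P ∘ (true ∷_)) ws
  go []       = refl
  go (w ∷ ws) = ≡-trans (sym (+-assoc (fromBool (P (false ∷ w))) _ _))
    (≡-trans (cong (fromBool (P (false ∷ w)) + fromBool (P (true ∷ w)) +_) (go ws))
           (+-interchange (fromBool (P (false ∷ w))) _ _ _))

count-cube≤1 : ∀ n (P : Vec Bool n → Bool) → Unique P → count P (cube n) ≤ 1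
count-cube≤1 zero    P _ rewrite +-identityʳ (fromBool (P [])) = fromBool≤1 (P [])
count-cube≤1 (suc n) P unique
  rewrite count-cube-suc P with count≡0⊎witness (P ∘ (false ∷_)) (cube n)
... | inj₁ none rewrite none = count-cube≤1 n (P ∘ (true ∷_)) (λ p q → ∷-injectiveʳ (unique p q))
... | inj₂ (w , Pw)
  rewrite count-none (P ∘ (true ∷_)) (cube n) (λ w' Pw' → case unique Pw Pw' of λ ())
        | +-identityʳ (count (P ∘ (false ∷_)) (cube n))
  = count-cube≤1 n (P ∘ (false ∷_)) (λ p q → ∷-injectiveʳ (unique p q))

count-cube≤2 : ∀ n (P q : Vec Bool n → Bool) →
  (∀ {w w'} → P w ≡ true → P w' ≡ true → q w ≡ q w' → w ≡ w') → count P (cube n) ≤ 2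
count-cube≤2 n P q determined rewrite count-split P q (cube n) =
  +-mono-≤ (count-cube≤1 n _ unique-q) (count-cube≤1 n _ unique-¬q)
  where
  unique-q : Unique (λ w → P w ∧ q w)
  unique-q Pqw Pqw' with ∧-true Pqw | ∧-true Pqw'
  ... | Pw , qw | Pw' , qw' = determined Pw Pw' (≡-trans qw (sym qw'))
  unique-¬q : Unique (λ w → P w ∧ not (q w))
  unique-¬q Pqw Pqw' with ∧-true Pqw | ∧-true Pqw'
  ... | Pw , qw | Pw' , qw' = determined Pw Pw' (not-injective (≡-trans qw (sym qw')))

vec-ext : ∀ {n} {u v : Vec Bool n} → (∀ i → lookup u i ≡ lookup v i) → u ≡ v
vec-ext {u = u} {v} eq =
  ≡-trans (sym (tabulate∘lookup u)) (≡-trans (tabulate-cong eq) (tabulate∘lookup v))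

countFin : (n : ℕ) → (Fin n → Bool) → ℕ
countFin zero    P = 0
countFin (suc n) P = fromBool (P zero) + countFin n (P ∘ suc)

Sole : ∀ {n} → (Fin n → Bool) → Fin n → Set
Sole P j = P j ≡ true × (∀ {k} → P k ≡ true → k ≡ j)

countFin-none : ∀ n (P : Fin n → Bool) → (∀ k → P k ≢ true) → countFin n P ≡ 0
countFin-none zero    P none = refl
countFin-none (suc n) P none with P zero in P0
... | true  = contradiction P0 (none zero)
... | false = countFin-none n (P ∘ suc) (none ∘ suc)

countFin≡0⇒none : ∀ n (P : Fin n → Bool) → countFin n P ≡ 0 → ∀ k → P k ≢ true
countFin≡0⇒none (suc n) P none k Pk with P zero in P0 | k
... | true  | _     = case none of λ ()
... | false | zero  = case ≡-trans (sym Pk) P0 of λ ()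
... | false | suc k = countFin≡0⇒none n (P ∘ suc) none k Pk

countFin≡1⇒sole : ∀ n (P : Fin n → Bool) → countFin n P ≡ 1 → ∃[ j ] Sole P j
countFin≡1⇒sole (suc n) P one with P zero in P0
... | true = zero , P0 , only
  where
  only : ∀ {k} → P k ≡ true → k ≡ zero
  only {zero}  _  = refl
  only {suc k} Pk = contradiction Pk (countFin≡0⇒none n (P ∘ suc) (suc-injective one) k)
... | false with countFin≡1⇒sole n (P ∘ suc) one
... | j , Pj , only = suc j , Pj , only′
  where
  only′ : ∀ {k} → P k ≡ true → k ≡ suc j
  only′ {zero}  Pk = case ≡-trans (sym Pk) P0 of λ ()
  only′ {suc k} Pk = cong suc (only Pk)

sole⇒countFin≡1 : ∀ n (P : Fin n → Bool) j → Sole P j → countFin n P ≡ 1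
sole⇒countFin≡1 (suc n) P zero (Pj , only) rewrite Pj =
  cong suc (countFin-none n (P ∘ suc) (λ k Pk → case only Pk of λ ()))
sole⇒countFin≡1 (suc n) P (suc j) (Pj , only) with P zero in P0
... | true  = case only P0 of λ ()
... | false = sole⇒countFin≡1 n (P ∘ suc) j (Pj , sucᶠ-injective ∘ only)

countFin≤-injection : ∀ n b (P : Fin n → Bool) (f : ∀ x → P x ≡ true → Fin b) →
  (∀ {x y} Px Py → f x Px ≡ f y Py → x ≡ y) → countFin n P ≤ b
countFin≤-injection zero    b P f f-inj = z≤n
countFin≤-injection (suc n) b P f f-inj with P zero in P0
... | false = countFin≤-injection n b (P ∘ suc) (f ∘ suc) (λ Px Py → sucᶠ-injective ∘ f-inj Px Py)
countFin≤-injection (suc n) zero    P f f-inj | true = case f zero P0 of λ ()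
countFin≤-injection (suc n) (suc b) P f f-inj | true =
  s≤s (countFin≤-injection n b (P ∘ suc) f′ f′-inj)
  where
  f₀≢ : ∀ x Px → f zero P0 ≢ f (suc x) Px
  f₀≢ x Px eq = case f-inj P0 Px eq of λ ()
  f′ : ∀ x → P (suc x) ≡ true → Fin b
  f′ x Px = punchOut (f₀≢ x Px)
  f′-inj : ∀ {x y} Px Py → f′ x Px ≡ f′ y Py → x ≡ y
  f′-inj {x} {y} Px Py eq =
    sucᶠ-injective (f-inj Px Py (punchOut-injective (f₀≢ x Px) (f₀≢ y Py) eq))

hasOneLaterPartner : (n : ℕ) → (Fin n → Fin n → Bool) → Fin n → Bool
hasOneLaterPartner (suc n) I zero    = countFin n (I zero ∘ suc) ≡ᵇ 1
hasOneLaterPartner (suc n) I (suc x) = hasOneLaterPartner n (λ a b → I (suc a) (suc b)) x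

hasOneLaterPartner⇒ : ∀ n (I : Fin n → Fin n → Bool) {x} → hasOneLaterPartner n I x ≡ true →
  ∃[ j ] x <ᶠ j × I x j ≡ true × (∀ {k} → x <ᶠ k → I x k ≡ true → k ≡ j)
hasOneLaterPartner⇒ (suc n) I {zero} one
  with countFin≡1⇒sole n (I zero ∘ suc) (≡ᵇ⇒≡ _ 1 (Equivalence.from T-≡ one))
... | j , Ij , only = suc j , s≤s z≤n , Ij , λ { {suc k} _ Ik → cong suc (only Ik) }
hasOneLaterPartner⇒ (suc n) I {suc x} one with hasOneLaterPartner⇒ n (λ a b → I (suc a) (suc b)) one
... | j , x<j , Ij , only = suc j , s≤s x<j , Ij , λ { {suc k} (s≤s x<k) Ik → cong suc (only x<k Ik) }

-- The counting argument for an abstract family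

weight : ∀ {n} → Vec Bool n → Fin n → Fin n → Fin n → ℕ
weight u i j k = fromBool (lookup u i) + fromBool (lookup u j) + fromBool (lookup u k)

record Family (n : ℕ) : Set where
  field
    member  : Vec Bool n → Bool
    support : Fin n → Bool
    indep   : Fin n → Fin n → Bool
    member⊆support : ∀ {u} i → member u ≡ true → lookup u i ≡ true → support i ≡ true
    indep-sym      : ∀ {x y} → indep x y ≡ true → indep y x ≡ true
    indep-trans    : ∀ {x y z} → indep x y ≡ true → indep y z ≡ true → x ≢ z → indep x z ≡ true
    dependent⇒unswappable : ∀ {x y u v} → x ≢ y → support x ≡ true → support y ≡ true →
      indep x y ≡ false → member u ≡ true → member v ≡ true →
      lookup u x ≡ false → lookup u y ≡ true → lookup v x ≡ true → lookup v y ≡ false → ⊥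
    independent⇒¬mixedWeights : ∀ {i j k u v} →
      indep i j ≡ true → indep j k ≡ true → indep i k ≡ true → member u ≡ true → member v ≡ true →
      weight u i j k ≡ 1 → weight v i j k ≡ 2 → ⊥

open Family

#oneLaterPartner : ∀ {n} → Family n → ℕ
#oneLaterPartner {n} F = countFin n (hasOneLaterPartner n (indep F))

shadow : ∀ {n} → Family (suc n) → Family n
shadow {n} F = record
  { member  = member′
  ; support = support F ∘ suc
  ; indep   = λ x y → indep F (suc x) (suc y)
  ; member⊆support = λ i m′ → member⊆support F (suc i) (proj₂ (lift m′))
  ; indep-sym      = indep-sym F
  ; indep-trans    = λ Ixy Iyz x≢z → indep-trans F Ixy Iyz (x≢z ∘ sucᶠ-injective)
  ; dependent⇒unswappable = λ x≢y Sx Sy Ixy mu mv →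
      dependent⇒unswappable F (x≢y ∘ sucᶠ-injective) Sx Sy Ixy (proj₂ (lift mu)) (proj₂ (lift mv))
  ; independent⇒¬mixedWeights = λ Iij Ijk Iik mu mv →
      independent⇒¬mixedWeights F Iij Ijk Iik (proj₂ (lift mu)) (proj₂ (lift mv))
  }
  where
  member′ : Vec Bool n → Bool
  member′ w = member F (false ∷ w) ∨ member F (true ∷ w)
  lift : ∀ {w} → member′ w ≡ true → ∃[ h ] member F (h ∷ w) ≡ true
  lift m′ with ∨-true m′
  ... | inj₁ m₀ = false , m₀
  ... | inj₂ m₁ = true , m₁

module Doubled {n} (F : Family (suc n)) where

  doubled : Vec Bool n → Bool
  doubled w = member F (false ∷ w) ∧ member F (true ∷ w)

  laterPartner : Fin n → Bool
  laterPartner j = indep F zero (suc j)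

  doubled-differ⇒sole : ∀ {w w' j} → doubled w ≡ true → doubled w' ≡ true →
    lookup w j ≡ true → lookup w' j ≡ false → Sole laterPartner j
  doubled-differ⇒sole {w} {w'} {j} dw dw' wj w'j with ∧-true dw | ∧-true dw'
  ... | m₀w , m₁w | m₀w' , m₁w' = I₀j , only
    where
    I₀j : indep F zero (suc j) ≡ true
    I₀j with indep F zero (suc j) in eq
    ... | true  = refl
    ... | false = ⊥-elim (dependent⇒unswappable F (λ ()) (member⊆support F zero m₁w refl)
                    (member⊆support F (suc j) m₀w wj) eq m₀w m₁w' refl wj refl w'j)
    only : ∀ {k} → indep F zero (suc k) ≡ true → k ≡ j
    only {k} I₀k with k ≟ᶠ j
    ... | yes k≡j = k≡j
    ... | no  k≢j = ⊥-elim (mixed (lookup w k) (lookup w' k) refl refl)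
      where
      ¬mixed : ∀ {h h' u v a b a' b'} → member F (h ∷ u) ≡ true → member F (h' ∷ v) ≡ true →
        lookup u j ≡ a → lookup u k ≡ b → lookup v j ≡ a' → lookup v k ≡ b' →
        fromBool h + fromBool a + fromBool b ≡ 1 → fromBool h' + fromBool a' + fromBool b' ≡ 2 → ⊥
      ¬mixed mu mv refl refl refl refl = independent⇒¬mixedWeights F I₀j
        (indep-trans F (indep-sym F I₀j) I₀k (k≢j ∘ sym ∘ sucᶠ-injective)) I₀k mu mv
      mixed : ∀ a b → lookup w k ≡ a → lookup w' k ≡ b → ⊥
      mixed false _     wk _   = ¬mixed m₀w  m₁w wj  wk  wj wk refl refl
      mixed true  false wk w'k = ¬mixed m₁w' m₀w w'j w'k wj wk refl refl
      mixed true  true  wk w'k = ¬mixed m₀w' m₀w w'j w'k wj wk refl refl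

  doubled-agree : ∀ {w w'} → doubled w ≡ true → doubled w' ≡ true →
    (∀ {j} → Sole laterPartner j → lookup w j ≡ lookup w' j) → w ≡ w'
  doubled-agree {w} {w'} dw dw' agree = vec-ext λ j →
    decidable-stable (lookup w j ≟ᵇ lookup w' j) (λ wj≢w'j → wj≢w'j (agree (differ wj≢w'j)))
    where
    differ : ∀ {j} → lookup w j ≢ lookup w' j → Sole laterPartner j
    differ {j} ne with lookup w j in wj | lookup w' j in w'j
    ... | true  | false = doubled-differ⇒sole dw dw' wj w'j
    ... | false | true  = doubled-differ⇒sole dw' dw w'j wj
    ... | true  | true  = contradiction refl ne
    ... | false | false = contradiction refl ne

  count-doubled≤ : count doubled (cube n) ≤
    fromBool (support F zero) + fromBool (hasOneLaterPartner (suc n) (indep F) zero)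
  count-doubled≤ with support F zero in S₀
  ... | false rewrite count-none doubled (cube n) (λ w dw →
        case ≡-trans (sym S₀) (member⊆support F zero (proj₂ (∧-true dw)) refl) of λ ()) = z≤n
  ... | true with countFin n laterPartner ≡ᵇ 1 in one
  ... | false = count-cube≤1 n doubled λ dw dw' → doubled-agree dw dw' λ {j} sole →
        case ≡-trans (sym one) (Equivalence.to T-≡ (≡⇒≡ᵇ _ 1 (sole⇒countFin≡1 n laterPartner j sole)))
        of λ ()
  ... | true with countFin≡1⇒sole n laterPartner (≡ᵇ⇒≡ _ 1 (Equivalence.from T-≡ one))
  ... | j₀ , _ , only = count-cube≤2 n doubled (λ w → lookup w j₀) λ {w} {w'} dw dw' agree₀ →
        doubled-agree dw dw' λ sole →
          subst (λ j → lookup w j ≡ lookup w' j) (sym (only (proj₁ sole))) agree₀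

count-members : ∀ n (F : Family n) →
  count (member F) (cube n) ≤ countFin n (support F) + #oneLaterPartner F + 1
count-members zero    F with member F []
... | true  = ≤-refl
... | false = z≤n
count-members (suc n) F = begin
  count (member F) (cube (suc n))
    ≡⟨ count-cube-suc (member F) ⟩
  count (member F ∘ (false ∷_)) (cube n) + count (member F ∘ (true ∷_)) (cube n)
    ≡⟨ count-∨+∧ _ _ (cube n) ⟩
  count (member F′) (cube n) + count doubled (cube n)
    ≤⟨ +-mono-≤ (count-members n F′) count-doubled≤ ⟩
  (countFin n (support F′) + #oneLaterPartner F′ + 1) + (fromBool (support F zero) + fromBool one₀)
    ≡⟨ rearrange (countFin n (support F′)) (#oneLaterPartner F′) (fromBool (support F zero))
                 (fromBool one₀) ⟩
  countFin (suc n) (support F) + #oneLaterPartner F + 1 ∎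
  where
  open ≤-Reasoning
  open Doubled F
  F′ : Family n
  F′ = shadow F
  one₀ : Bool
  one₀ = hasOneLaterPartner (suc n) (indep F) zero
  rearrange : ∀ a b c d → (a + b + 1) + (c + d) ≡ (c + a) + (d + b) + 1
  rearrange = solve-∀

indep<⇒¬bothOneLaterPartner : ∀ {n} (F : Family n) {x y} → x <ᶠ y → indep F x y ≡ true →
  hasOneLaterPartner n (indep F) x ≡ true → hasOneLaterPartner n (indep F) y ≡ true → ⊥
indep<⇒¬bothOneLaterPartner {n} F {x} {y} x<y Ixy Px Py
  with hasOneLaterPartner⇒ n (indep F) Px | hasOneLaterPartner⇒ n (indep F) Py
... | _ , _ , _ , only-x | j , y<j , Iyj , _ =
  <-irrefl (≡-trans (only-x x<y Ixy) (sym (only-x x<j (indep-trans F Ixy Iyj (<⇒≢ x<j))))) y<j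
  where
  x<j : x <ᶠ j
  x<j = <-trans x<y y<j

indep⇒¬bothOneLaterPartner : ∀ {n} (F : Family n) {x y} → x ≢ y → indep F x y ≡ true →
  hasOneLaterPartner n (indep F) x ≡ true → hasOneLaterPartner n (indep F) y ≡ true → ⊥
indep⇒¬bothOneLaterPartner F {x} {y} x≢y Ixy Px Py with <-cmp x y
... | tri< x<y _ _ = indep<⇒¬bothOneLaterPartner F x<y Ixy Px Py
... | tri≈ _ x≡y _ = x≢y x≡y
... | tri> _ _ y<x = indep<⇒¬bothOneLaterPartner F y<x (indep-sym F Ixy) Py Px

-- Choices, the relation R and independence

module _ {m : ℕ} (B : Choice m) where

  private
    term : Bool → Bool → Bool → Bool → Bool
    term s p q r = if s then isE B p q r else isEbar B p q r

    term-swap : ∀ s p q r → term s p q r ≡ term s p r q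
    term-swap true  p q r = cong (p ∧_) (∧-comm (not q) (not r))
    term-swap false p q r = cong (not p ∧_) (∧-comm q r)

  memB-swap₁₂ : ∀ a b c p q r → memB B a b c p q r ≡ memB B b a c q p r
  memB-swap₁₂ a b c p q r =
    ≡-trans (∨-leftComm (term (sel B a b c) p q r) (term (sel B b a c) q p r) (term (sel B c a b) r p q))
    (cong (λ t → term (sel B b a c) q p r ∨ term (sel B a b c) p q r ∨ t)
      (≡-trans (cong (λ s → term s r p q) (sel-sym B c a b)) (term-swap _ r p q)))

  memB-swap₂₃ : ∀ a b c p q r → memB B a b c p q r ≡ memB B a c b p r q
  memB-swap₂₃ a b c p q r = cong₂ _∨_
    (≡-trans (cong (λ s → term s p q r) (sel-sym B a b c)) (term-swap _ p q r))
    (∨-comm (term (sel B b a c) q p r) _)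

  -- Uniform true = TypeI B and Uniform false = TypeIc B, definitionally.
  Uniform : Bool → Fin m → Fin m → Fin m → Set
  Uniform s x y z = sel B x y z ≡ s × sel B y x z ≡ s × sel B z x y ≡ s

  Uniform-swap₁₂ : ∀ {s x y z} → Uniform s x y z → Uniform s y x z
  Uniform-swap₁₂ {x = x} {y} {z} (sxyz , syxz , szxy) = syxz , sxyz , ≡-trans (sel-sym B z y x) szxy

  Uniform-swap₂₃ : ∀ {s x y z} → Uniform s x y z → Uniform s x z y
  Uniform-swap₂₃ {x = x} {y} {z} (sxyz , syxz , szxy) = ≡-trans (sel-sym B x z y) sxyz , szxy , syxz

  typeI-weight≡1⇒∈B : ∀ {i j k} p q r → TypeI B i j k →
    fromBool p + fromBool q + fromBool r ≡ 1 → memB B i j k p q r ≡ true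
  typeI-weight≡1⇒∈B p q r (s₁ , s₂ , s₃) w rewrite s₁ | s₂ | s₃ = weight≡1⇒isE p q r w
    where
    weight≡1⇒isE : ∀ p q r → fromBool p + fromBool q + fromBool r ≡ 1 →
      (isE B p q r ∨ isE B q p r ∨ isE B r p q) ≡ true
    weight≡1⇒isE true  false false _ = refl
    weight≡1⇒isE false true  false _ = refl
    weight≡1⇒isE false false true  _ = refl
    weight≡1⇒isE true  true  _     ()
    weight≡1⇒isE true  false true  ()
    weight≡1⇒isE false true  true  ()
    weight≡1⇒isE false false false ()

  typeIc-weight≡2⇒∈B : ∀ {i j k} p q r → TypeIc B i j k →
    fromBool p + fromBool q + fromBool r ≡ 2 → memB B i j k p q r ≡ true
  typeIc-weight≡2⇒∈B p q r (s₁ , s₂ , s₃) w rewrite s₁ | s₂ | s₃ = weight≡2⇒isEbar p q r w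
    where
    weight≡2⇒isEbar : ∀ p q r → fromBool p + fromBool q + fromBool r ≡ 2 →
      (isEbar B p q r ∨ isEbar B q p r ∨ isEbar B r p q) ≡ true
    weight≡2⇒isEbar true  true  false _ = refl
    weight≡2⇒isEbar true  false true  _ = refl
    weight≡2⇒isEbar false true  true  _ = refl
    weight≡2⇒isEbar true  true  true  ()
    weight≡2⇒isEbar true  false false ()
    weight≡2⇒isEbar false true  false ()
    weight≡2⇒isEbar false false true  ()
    weight≡2⇒isEbar false false false ()

  Distinct3-swap₁₂ : ∀ {x y z} → Distinct3 B x y z → Distinct3 B y x z
  Distinct3-swap₁₂ (x≢y , y≢z , x≢z) = ≢-sym x≢y , x≢z , y≢z

  Distinct3-swap₂₃ : ∀ {x y z} → Distinct3 B x y z → Distinct3 B x z y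
  Distinct3-swap₂₃ (x≢y , y≢z , x≢z) = x≢z , ≢-sym y≢z , x≢y

  module _ (X : Subset m) where

    good : Vec Bool m → Bool
    good u = supportedᵇ B X u ∧ avoidsᵇ B X u

    allᵇ-∈ : ∀ {A : Set} (p : A → Bool) {xs x} → allᵇ B X p xs ≡ true → x List.∈ xs → p x ≡ true
    allᵇ-∈ p {y ∷ _} all (here refl) with p y
    ... | true = refl
    allᵇ-∈ p {y ∷ _} all (there x∈) with p y
    ... | true = allᵇ-∈ p all x∈

    allᵇ-allFin : ∀ (p : Fin m → Bool) → allᵇ B X p (allFin m) ≡ true → ∀ x → p x ≡ true
    allᵇ-allFin p all x = allᵇ-∈ p all (∈-allFin x)

    good⇒supported : ∀ u i → good u ≡ true → lookup u i ≡ true → lookup X i ≡ true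
    good⇒supported u i g ui =
      subst (λ b → (not b ∨ lookup X i) ≡ true) ui (allᵇ-allFin _ (proj₁ (∧-true g)) i)

    inB : Vec Bool m → Fin m → Fin m → Fin m → Bool
    inB u a b c = memB B a b c (lookup u a) (lookup u b) (lookup u c)

    inB-swap₁₂ : ∀ u a b c → inB u a b c ≡ inB u b a c
    inB-swap₁₂ u a b c = memB-swap₁₂ a b c (lookup u a) (lookup u b) (lookup u c)

    inB-swap₂₃ : ∀ u a b c → inB u a b c ≡ inB u a c b
    inB-swap₂₃ u a b c = memB-swap₂₃ a b c (lookup u a) (lookup u b) (lookup u c)

    good⇒avoids-sorted : ∀ u {a b c} → good u ≡ true → a ∈ X → b ∈ X → c ∈ X → a <ᶠ b → b <ᶠ c →
      inB u a b c ≡ false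
    good⇒avoids-sorted u {a} {b} {c} g a∈X b∈X c∈X a<b b<c =
      not-injective (subst (λ t → (not t ∨ not M) ≡ true) in-range avoids)
      where
      M : Bool
      M = inB u a b c
      avoids : (not (lookup X a ∧ lookup X b ∧ lookup X c ∧ ⌊ a <ᶠ? b ⌋ ∧ ⌊ b <ᶠ? c ⌋) ∨ not M)
               ≡ true
      avoids = allᵇ-allFin _ (allᵇ-allFin _ (allᵇ-allFin _ (proj₂ (∧-true g)) a) b) c
      in-range : (lookup X a ∧ lookup X b ∧ lookup X c ∧ ⌊ a <ᶠ? b ⌋ ∧ ⌊ b <ᶠ? c ⌋) ≡ true
      in-range rewrite []=⇒lookup a∈X | []=⇒lookup b∈X | []=⇒lookup c∈X
                     | ≡-trans (isYes≗does (a <ᶠ? b)) (dec-true (a <ᶠ? b) a<b)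
                     | ≡-trans (isYes≗does (b <ᶠ? c)) (dec-true (b <ᶠ? c) b<c) = refl

    good⇒avoids : ∀ u {x y z} → good u ≡ true → x ∈ X → y ∈ X → z ∈ X → Distinct3 B x y z →
      inB u x y z ≡ false
    good⇒avoids u {x} {y} {z} g x∈X y∈X z∈X (x≢y , y≢z , x≢z)
      with <-cmp x y | <-cmp y z | <-cmp x z
    ... | tri≈ _ x≡y _ | _ | _ = contradiction x≡y x≢y
    ... | _ | tri≈ _ y≡z _ | _ = contradiction y≡z y≢z
    ... | _ | _ | tri≈ _ x≡z _ = contradiction x≡z x≢z
    ... | tri< x<y _ _ | tri< y<z _ _ | _ = good⇒avoids-sorted u g x∈X y∈X z∈X x<y y<z
    ... | tri< x<y _ _ | tri> _ _ z<y | tri< x<z _ _ =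
      ≡-trans (inB-swap₂₃ u x y z) (good⇒avoids-sorted u g x∈X z∈X y∈X x<z z<y)
    ... | tri< x<y _ _ | tri> _ _ z<y | tri> _ _ z<x =
      ≡-trans (inB-swap₂₃ u x y z)
        (≡-trans (inB-swap₁₂ u x z y) (good⇒avoids-sorted u g z∈X x∈X y∈X z<x x<y))
    ... | tri> _ _ y<x | tri< y<z _ _ | tri< x<z _ _ =
      ≡-trans (inB-swap₁₂ u x y z) (good⇒avoids-sorted u g y∈X x∈X z∈X y<x x<z)
    ... | tri> _ _ y<x | tri< y<z _ _ | tri> _ _ z<x =
      ≡-trans (inB-swap₁₂ u x y z)
        (≡-trans (inB-swap₂₃ u y x z) (good⇒avoids-sorted u g y∈X z∈X x∈X y<z z<x))
    ... | tri> _ _ y<x | tri> _ _ z<y | _ =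
      ≡-trans (inB-swap₁₂ u x y z) (≡-trans (inB-swap₂₃ u y x z) (≡-trans (inB-swap₁₂ u y z x)
        (good⇒avoids-sorted u g z∈X y∈X x∈X z<y y<x)))

    good⇒∉B : ∀ u {x y z p q r} → good u ≡ true → x ∈ X → y ∈ X → z ∈ X → Distinct3 B x y z →
      lookup u x ≡ p → lookup u y ≡ q → lookup u z ≡ r → memB B x y z p q r ≡ false
    good⇒∉B u g x∈X y∈X z∈X d refl refl refl = good⇒avoids u g x∈X y∈X z∈X d

    R⇒∈X : ∀ {x y} → R B X x y → x ∈ X × y ∈ X
    R⇒∈X (edge x∈X y∈X _ _ _)  = x∈X , y∈X
    R⇒∈X (trans _ Rij Rjk)     = proj₁ (R⇒∈X Rij) , proj₂ (R⇒∈X Rjk)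
    R⇒∈X (ruleI k∈X _ _ Rij)   = proj₁ (R⇒∈X Rij) , k∈X
    R⇒∈X (ruleIc k∈X _ _ Rij)  = k∈X , proj₂ (R⇒∈X Rij)

    R⇒¬01 : ∀ {x y} → R B X x y → ∀ u → good u ≡ true → lookup u x ≡ false → lookup u y ≡ true → ⊥
    R⇒¬01 (edge {z = z} x∈X y∈X z∈X d (e₀ , e₁)) u g ux uy with lookup u z in uz
    ... | false = case ≡-trans (sym e₀) (good⇒∉B u g x∈X y∈X z∈X d ux uy uz) of λ ()
    ... | true  = case ≡-trans (sym e₁) (good⇒∉B u g x∈X y∈X z∈X d ux uy uz) of λ ()
    R⇒¬01 (trans {j = j} _ Rij Rjk) u g ui uk with lookup u j in uj
    ... | true  = R⇒¬01 Rij u g ui uj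
    ... | false = R⇒¬01 Rjk u g uj uk
    R⇒¬01 (ruleI {j = j} k∈X d U Rij) u g ui uk with lookup u j in uj
    ... | true  = R⇒¬01 Rij u g ui uj
    ... | false = case ≡-trans (sym (typeI-weight≡1⇒∈B false false true U refl))
                    (good⇒∉B u g (proj₁ (R⇒∈X Rij)) (proj₂ (R⇒∈X Rij)) k∈X d ui uj uk) of λ ()
    R⇒¬01 (ruleIc {i = i} k∈X d U Rij) u g uk uj with lookup u i in ui
    ... | false = R⇒¬01 Rij u g ui uj
    ... | true  = case ≡-trans (sym (typeIc-weight≡2⇒∈B true true false U refl))
                    (good⇒∉B u g (proj₁ (R⇒∈X Rij)) (proj₂ (R⇒∈X Rij)) k∈X d ui uj uk) of λ ()

    sel⇒R : ∀ {x y z} → x ∈ X → y ∈ X → z ∈ X → Distinct3 B x y z →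
      sel B y x z ≡ true → sel B x y z ≡ false → R B X x y
    sel⇒R {x} {y} {z} x∈X y∈X z∈X d syxz sxyz = edge x∈X y∈X z∈X d (e_y∈B , ēx∈B)
      where
      e_y∈B : memB B x y z false true false ≡ true
      e_y∈B rewrite syxz | sxyz = refl
      ēx∈B : memB B x y z false true true ≡ true
      ēx∈B rewrite sxyz = refl

    ¬R⇒sel≡ : ∀ {x y z} → x ∈ X → y ∈ X → z ∈ X → Distinct3 B x y z →
      ¬ R B X x y → ¬ R B X y x → sel B x y z ≡ sel B y x z
    ¬R⇒sel≡ {x} {y} {z} x∈X y∈X z∈X d ¬Rxy ¬Ryx with sel B x y z in sxyz | sel B y x z in syxz
    ... | true  | true  = refl
    ... | false | false = refl
    ... | false | true  = contradiction (sel⇒R x∈X y∈X z∈X d syxz sxyz) ¬Rxy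
    ... | true  | false = contradiction (sel⇒R y∈X x∈X z∈X (Distinct3-swap₁₂ d) sxyz syxz) ¬Ryx

    Indep-sym : ∀ {x y} → Indep B X x y → Indep B X y x
    Indep-sym (x∈X , y∈X , x≢y , ¬Rxy , ¬Ryx) = y∈X , x∈X , ≢-sym x≢y , ¬Ryx , ¬Rxy

    Indep-triangle⇒Uniform : ∀ {x y z} → Indep B X x y → Indep B X y z → x ≢ z →
      ∃[ s ] Uniform s x y z
    Indep-triangle⇒Uniform {x} {y} {z}
      (x∈X , y∈X , x≢y , ¬Rxy , ¬Ryx) (_ , z∈X , y≢z , ¬Ryz , ¬Rzy) x≢z =
      sel B x y z , refl , sym sxyz≡syxz , szxy≡sxyz
      where
      sxyz≡syxz : sel B x y z ≡ sel B y x z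
      sxyz≡syxz = ¬R⇒sel≡ x∈X y∈X z∈X (x≢y , y≢z , x≢z) ¬Rxy ¬Ryx
      syzx≡szyx : sel B y z x ≡ sel B z y x
      syzx≡szyx = ¬R⇒sel≡ y∈X z∈X x∈X (y≢z , ≢-sym x≢z , ≢-sym x≢y) ¬Ryz ¬Rzy
      szxy≡sxyz : sel B z x y ≡ sel B x y z
      szxy≡sxyz = begin
        sel B z x y ≡⟨ sel-sym B z x y ⟩
        sel B z y x ≡⟨ sym syzx≡szyx ⟩
        sel B y z x ≡⟨ sel-sym B y z x ⟩
        sel B y x z ≡⟨ sym sxyz≡syxz ⟩
        sel B x y z ∎
        where open ≡-Reasoning

    -- The triple is of type I or I^c, and then ruleI (resp. ruleIc) turns R x z
    -- or R z x into a relation between y and x or z.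
    Indep-trans : ∀ {x y z} → Indep B X x y → Indep B X y z → x ≢ z → Indep B X x z
    Indep-trans {x} {y} {z}
      Ixy@(x∈X , y∈X , x≢y , ¬Rxy , ¬Ryx) Iyz@(_ , z∈X , y≢z , ¬Ryz , ¬Rzy) x≢z
      with Indep-triangle⇒Uniform Ixy Iyz x≢z
    ... | true , U = x∈X , z∈X , x≢z ,
          (λ Rxz → ¬Rxy (ruleI y∈X dxzy (Uniform-swap₂₃ U) Rxz)) ,
          (λ Rzx → ¬Rzy (ruleI y∈X (Distinct3-swap₁₂ dxzy) (Uniform-swap₁₂ (Uniform-swap₂₃ U)) Rzx))
      where
      dxzy : Distinct3 B x z y
      dxzy = Distinct3-swap₂₃ (x≢y , y≢z , x≢z)
    ... | false , U = x∈X , z∈X , x≢z ,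
          (λ Rxz → ¬Ryz (ruleIc y∈X dxzy (Uniform-swap₂₃ U) Rxz)) ,
          (λ Rzx → ¬Ryx (ruleIc y∈X (Distinct3-swap₁₂ dxzy) (Uniform-swap₁₂ (Uniform-swap₂₃ U)) Rzx))
      where
      dxzy : Distinct3 B x z y
      dxzy = Distinct3-swap₂₃ (x≢y , y≢z , x≢z)

    Conn⇒≡⊎Indep : ∀ {x z} → Conn B X x z → x ≡ z ⊎ Indep B X x z
    Conn⇒≡⊎Indep (here _) = inj₁ refl
    Conn⇒≡⊎Indep (step {i} {j} {k} Iij Cjk) with Conn⇒≡⊎Indep Cjk
    ... | inj₁ refl = inj₂ Iij
    ... | inj₂ Ijk with i ≟ᶠ k
    ...   | yes i≡k = inj₁ i≡k
    ...   | no  i≢k = inj₂ (Indep-trans Iij Ijk i≢k)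

    sameBlock⇒≡⊎Indep : ∀ {x y z} → Conn B X x z → Conn B X y z → x ≡ y ⊎ Indep B X x y
    sameBlock⇒≡⊎Indep {x} {y} Cxz Cyz with Conn⇒≡⊎Indep Cxz | Conn⇒≡⊎Indep Cyz
    ... | inj₁ refl | inj₁ refl = inj₁ refl
    ... | inj₁ refl | inj₂ Iyz  = inj₂ (Indep-sym Iyz)
    ... | inj₂ Ixz  | inj₁ refl = inj₂ Ixz
    ... | inj₂ Ixz  | inj₂ Iyz with x ≟ᶠ y
    ...   | yes x≡y = inj₁ x≡y
    ...   | no  x≢y = inj₂ (Indep-trans Ixz (Indep-sym Iyz) x≢y)

    module _ (R? : ∀ x y → Dec (R B X x y)) where

      Indep? : ∀ x y → Dec (Indep B X x y)
      Indep? x y = x ∈? X ×-dec y ∈? X ×-dec ¬? (x ≟ᶠ y) ×-dec ¬? (R? x y) ×-dec ¬? (R? y x)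

      independent : Fin m → Fin m → Bool
      independent x y = does (Indep? x y)

      independent≡false⇒unswappable : ∀ {x y} u v → x ≢ y → lookup X x ≡ true → lookup X y ≡ true →
        independent x y ≡ false → good u ≡ true → good v ≡ true →
        lookup u x ≡ false → lookup u y ≡ true → lookup v x ≡ true → lookup v y ≡ false → ⊥
      independent≡false⇒unswappable {x} {y} u v x≢y Xx Xy ¬Ixy gu gv ux uy vx vy
        with does≡false⇒¬ (Indep? x y) ¬Ixy | R? x y | R? y x
      ... | _      | yes Rxy | _       = R⇒¬01 Rxy u gu ux uy
      ... | _      | no  _   | yes Ryx = R⇒¬01 Ryx v gv vy vx
      ... | ¬Indep | no ¬Rxy | no ¬Ryx =
        ¬Indep (lookup⇒[]= x X Xx , lookup⇒[]= y X Xy , x≢y , ¬Rxy , ¬Ryx)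

      independent-triangle⇒¬mixedWeights : ∀ {i j k} u v →
        independent i j ≡ true → independent j k ≡ true → independent i k ≡ true →
        good u ≡ true → good v ≡ true → weight u i j k ≡ 1 → weight v i j k ≡ 2 → ⊥
      independent-triangle⇒¬mixedWeights {i} {j} {k} u v Iij Ijk Iik gu gv wu wv
        with does⇒ (Indep? i j) Iij | does⇒ (Indep? j k) Ijk | does⇒ (Indep? i k) Iik
      ... | Iij′@(i∈X , j∈X , i≢j , _) | Ijk′@(_ , k∈X , j≢k , _) | (_ , _ , i≢k , _)
        with Indep-triangle⇒Uniform Iij′ Ijk′ i≢k
      ... | true , U = case ≡-trans (sym (typeI-weight≡1⇒∈B (lookup u i) (lookup u j) (lookup u k) U wu))
              (good⇒avoids u gu i∈X j∈X k∈X (i≢j , j≢k , i≢k)) of λ ()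
      ... | false , U = case ≡-trans (sym (typeIc-weight≡2⇒∈B (lookup v i) (lookup v j) (lookup v k) U wv))
              (good⇒avoids v gv i∈X j∈X k∈X (i≢j , j≢k , i≢k)) of λ ()

      goodFamily : Family m
      goodFamily = record
        { member  = good
        ; support = lookup X
        ; indep   = independent
        ; member⊆support = λ {u} → good⇒supported u
        ; indep-sym      = λ {x} {y} Ixy → dec-true (Indep? y x) (Indep-sym (does⇒ (Indep? x y) Ixy))
        ; indep-trans    = λ {x} {y} {z} Ixy Iyz x≢z →
            dec-true (Indep? x z) (Indep-trans (does⇒ (Indep? x y) Ixy) (does⇒ (Indep? y z) Iyz) x≢z)
        ; dependent⇒unswappable     = λ {u = u} {v = v} → independent≡false⇒unswappable u v
        ; independent⇒¬mixedWeights = λ {u = u} {v = v} → independent-triangle⇒¬mixedWeights u v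
        }

      #oneLaterPartner≤#blocks : ∀ {b} → IsBlockCount B X b → #oneLaterPartner goodFamily ≤ b
      #oneLaterPartner≤#blocks {b} (rep , _ , _ , cover) =
        countFin≤-injection m b (hasOneLaterPartner m independent) block block-injective
        where
        inBigBlock : ∀ x → hasOneLaterPartner m independent x ≡ true → InBigBlock B X x
        inBigBlock x P with hasOneLaterPartner⇒ m independent P
        ... | j , _ , Ixj , _ = j , does⇒ (Indep? x j) Ixj
        block : ∀ x → hasOneLaterPartner m independent x ≡ true → Fin b
        block x P = proj₁ (cover x (inBigBlock x P))
        block-injective : ∀ {x y} Px Py → block x Px ≡ block y Py → x ≡ y
        block-injective {x} {y} Px Py same
          with sameBlock⇒≡⊎Indep (proj₂ (cover x (inBigBlock x Px)))
                 (subst (Conn B X y ∘ rep) (sym same) (proj₂ (cover y (inBigBlock y Py))))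
        ... | inj₁ x≡y = x≡y
        ... | inj₂ Ixy = ⊥-elim (indep⇒¬bothOneLaterPartner goodFamily (proj₁ (proj₂ (proj₂ Ixy)))
                                  (dec-true (Indep? x y) Ixy) Px Py)

allVecs≡cube : ∀ {m} (B : Choice m) (X : Subset m) n → allVecs B X n ≡ cube n
allVecs≡cube B X zero    = refl
allVecs≡cube B X (suc n) =
  cong (concatMap (λ v → (false ∷ v) ∷ (true ∷ v) ∷ [])) (allVecs≡cube B X n)

countFin-lookup : ∀ {n} (X : Subset n) → countFin n (lookup X) ≡ ∣ X ∣
countFin-lookup []          = refl
countFin-lookup (true  ∷ X) = cong suc (countFin-lookup X)
countFin-lookup (false ∷ X) = countFin-lookup X

c≤∣X∣+#blocks+1 : ∀ {m} (B : Choice m) (X : Subset m) → (∀ x y → Dec (R B X x y)) →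
  ∀ {b} → IsBlockCount B X b → c B X ≤ ∣ X ∣ + b + 1
c≤∣X∣+#blocks+1 {m} B X R? {b} blocks = begin
  c B X
    ≡⟨ cong (length ∘ filterᵇ (good B X)) (allVecs≡cube B X m) ⟩
  length (filterᵇ (good B X) (cube m))
    ≡⟨ length-filterᵇ (good B X) (cube m) ⟩
  count (good B X) (cube m)
    ≤⟨ count-members m (goodFamily B X R?) ⟩
  countFin m (lookup X) + #oneLaterPartner (goodFamily B X R?) + 1
    ≤⟨ +-monoˡ-≤ 1 (+-mono-≤ (≤-reflexive (countFin-lookup X))
                              (#oneLaterPartner≤#blocks B X R? blocks)) ⟩
  ∣ X ∣ + b + 1 ∎
  where open ≤-Reasoning

¬¬-decidable₂ : ∀ {n} (P : Fin n → Fin n → Set) → ¬ ¬ (∀ x y → Dec (P x y))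
¬¬-decidable₂ P = sequence ¬¬-applicative λ x → sequence ¬¬-applicative λ y → ¬¬-excluded-middle
  where
  ¬¬-applicative : RawApplicative DoubleNegation
  ¬¬-applicative = RawMonad.rawApplicative ¬¬-Monad

-- R is inductively defined and not obviously decidable, but the conclusion is
-- a decidable inequality, so excluded middle for R may be assumed.
lemma3p8 : (m : ℕ) (B : Choice m) (X : Subset m) (b : ℕ) →
    IsBlockCount B X b → c B X ≤ ∣ X ∣ + b + 1
lemma3p8 m B X b blocks = decidable-stable (c B X ≤? ∣ X ∣ + b + 1)
  (¬¬-map (λ R? → c≤∣X∣+#blocks+1 B X R? blocks) (¬¬-decidable₂ (R B X)))
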